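{- For all integers $n\ge 0$ and $m\ge 1$, $|\mathcal{T}(n,m)| = |\mathcal{C}(n,m)|$, where $\mathcal{T}(n,m)=\{(w,T) : w\in\hat{\mathcal{P}}(n,m),\ T \text{ a } w\text{ -valid plane tree}\}$ and $\mathcal{C}(n,m)=\{(c,T): T \text{ a plane tree with } n \text{ edges},\ c:E(T)\to\{1,\dots,m\}\}$ (colorings $c$ not required to be proper).
   Context: Fix an alphabet $\{A_1,\overline{A}_1,\dots,A_m,\overline{A}_m\}$ of $m$ letters and their complements; $A_i$ and $\overline{A}_i$ are called complements. A plane tree is a rooted tree embedded in the plane with the root on top, so children of each vertex are ordered left to right. Its half edges are ordered by starting at the root and tracing the perimeter counterclockwise, touching each side of each edge exactly once. For a word $w=w[1]\cdots w[2n]$ and a plane tree $T$ with $n$ edges, label the $i$-th half edge by $w[i]$; $T$ is $w$-valid if for each edge the two letters labeling its two half edges are complements. A word is foldable if some plane tree is $w$-valid. $\hat{\mathcal{P}}(n,m)$ is the set of foldable words of length $2n$ over this alphabet in which every letter in an odd position lies in $\{A_1,\dots,A_m\}$ and every letter in an even position lies in $\{\overline{A}_1,\dots,\overline{A}_m\}$. -}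

module Defs where

open import Data.Nat using (ℕ; zero; suc; _+_; _*_)
open import Data.Fin using (Fin)
open import Data.List using (List; []; _∷_; length)
open import Data.Vec using (Vec)
open import Data.Product using (Σ; Σ-syntax; _×_)
open import Relation.Binary.PropositionalEquality using (_≡_)

data Tree : Set where
  node : List Tree → Tree

edgesF : List Tree → ℕ
edgesF [] = 0
edgesF (node cs ∷ ts) = suc (edgesF cs + edgesF ts)

edges : Tree → ℕ
edges (node ts) = edgesF ts

-- Alphabet {A_1, Ā_1, ..., A_m, Ā_m}; letter indices are Fin m (A_{i+1} = A i).
data Letter (m : ℕ) : Set where
  A    : Fin m → Letter m
  Abar : Fin m → Letter m

data Complement {m : ℕ} : Letter m → Letter m → Set where
  A-Abar : ∀ i → Complement (A i) (Abar i)
  Abar-A : ∀ i → Complement (Abar i) (A i)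

-- Labelling of half edges along the counterclockwise perimeter walk from the root:
-- for a vertex with children t₁ … t_k (left to right), the walk goes down the edge to t₁
-- (one half edge), walks around t₁, comes back up that edge (the other half edge),
-- then does the same for t₂, …, t_k.
-- ValidF ts w r : the walk around the forest ts reads the prefix of w before r as labels,
-- and for every edge the two labels of its half edges are complements.
data ValidF {m : ℕ} : List Tree → List (Letter m) → List (Letter m) → Set where
  done : ∀ {w} → ValidF [] w w
  edge : ∀ {a b cs ts w w' r} →
         Complement a b →
         ValidF cs w (b ∷ w') →
         ValidF ts w' r →
         ValidF (node cs ∷ ts) (a ∷ w) r

WValid : {m : ℕ} → List (Letter m) → Tree → Set
WValid w (node ts) = ValidF ts w []

-- w is foldable: some plane tree is w-valid.  The witness is irrelevant, so
-- Foldable w is a proposition (a mere property of w).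
record Foldable {m : ℕ} (w : List (Letter m)) : Set where
  constructor folds
  field
    .witness : Σ Tree (WValid w)

data IsA {m : ℕ} : Letter m → Set where
  isA : ∀ i → IsA (A i)

data IsAbar {m : ℕ} : Letter m → Set where
  isAbar : ∀ i → IsAbar (Abar i)

data Alternating {m : ℕ} : List (Letter m) → Set where
  alt-nil  : Alternating []
  alt-cons : ∀ {x y w} → IsA x → IsAbar y → Alternating w → Alternating (x ∷ y ∷ w)

InPhat : (n m : ℕ) → List (Letter m) → Set
InPhat n m w = (length w ≡ 2 * n) × Alternating w × Foldable w

𝒯 : ℕ → ℕ → Set
𝒯 n m = Σ[ w ∈ List (Letter m) ] Σ[ T ∈ Tree ] (InPhat n m w × WValid w T)

-- 𝒞(n,m) = {(c,T) : T a plane tree with n edges, c : E(T) → {1,…,m}}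
-- (edges listed in a fixed order, so a colouring is a vector of length |E(T)|)
𝒞 : ℕ → ℕ → Set
𝒞 n m = Σ[ T ∈ Tree ] Σ[ e ∈ edges T ≡ n ] Vec (Fin m) (edges T)

-- In a word whose letters alternate between some A_i and some Ā_j, the first half edge of
-- an edge hanging below a vertex at even depth sits at an odd position, and the first half
-- edge below a vertex at odd depth at an even one.  So in a w-valid tree every edge reads
-- either (A_i, Ā_i) or (Ā_i, A_i) with the orientation fixed by depth, and w is recovered
-- from the tree and the index i of each edge.  Conversely every tree with an arbitrary
-- colouring of its edges spells out such a word.  Hence (w, T) ↦ (T, edge indices) is a
-- bijection; the proof components of 𝒯 and 𝒞 are unique, so it is one on the Σ-types.
module Submission where

open import Defs
open import Data.Nat using (ℕ; _≤_; suc; _+_; _*_)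
open import Data.Nat.Properties using (≡-irrelevant; *-cancelˡ-≡; +-identityʳ)
open import Data.Nat.Tactic.RingSolver using (solve-∀)
open import Data.Bool using (Bool; true; false; not)
open import Data.Bool.Properties using (not-involutive)
open import Data.Fin using (Fin)
open import Data.List using (List; []; _∷_; length)
open import Data.Vec using (Vec; []; _∷_; _++_; take; drop)
open import Data.Vec.Properties using (take++drop≡id; ++-injectiveˡ; ++-injectiveʳ)
open import Data.Product using (_×_; _,_)
open import Function.Bundles using (_↔_; mk↔ₛ′)
open import Relation.Binary.PropositionalEquality
  using (_≡_; refl; sym; trans; cong; cong₂; subst; module ≡-Reasoning)

private variable
  m : ℕ
  A′ : Set

take-++ : ∀ {k l} (xs : Vec A′ k) (ys : Vec A′ l) → take k (xs ++ ys) ≡ xs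
take-++ {k = k} xs ys = sym (++-injectiveˡ xs _ (sym (take++drop≡id k (xs ++ ys))))

drop-++ : ∀ {k l} (xs : Vec A′ k) (ys : Vec A′ l) → drop k (xs ++ ys) ≡ ys
drop-++ {k = k} xs ys = sym (++-injectiveʳ xs _ (sym (take++drop≡id k (xs ++ ys))))

letter : Bool → Fin m → Letter m
letter true  = A
letter false = Abar

letter-complement : ∀ b (i : Fin m) → Complement (letter b i) (letter (not b) i)
letter-complement true  i = A-Abar i
letter-complement false i = Abar-A i

index : {a b : Letter m} → Complement a b → Fin m
index (A-Abar i) = i
index (Abar-A i) = i

index-letter-complement : ∀ b (i : Fin m) → index (letter-complement b i) ≡ i
index-letter-complement true  i = refl
index-letter-complement false i = refl

Complement-irrelevant : {a b : Letter m} (c d : Complement a b) → c ≡ d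
Complement-irrelevant (A-Abar i) (A-Abar .i) = refl
Complement-irrelevant (Abar-A i) (Abar-A .i) = refl

perimeterWord : Bool → (ts : List Tree) → Vec (Fin m) (edgesF ts) → List (Letter m) → List (Letter m)
perimeterWord b []             []      r = r
perimeterWord b (node cs ∷ ts) (i ∷ v) r =
  letter b i ∷ perimeterWord (not b) cs (take (edgesF cs) v)
                 (letter (not b) i ∷ perimeterWord b ts (drop (edgesF cs) v) r)

perimeterWord-valid : ∀ b ts (v : Vec (Fin m) (edgesF ts)) r → ValidF ts (perimeterWord b ts v r) r
perimeterWord-valid b []             []      r = done
perimeterWord-valid b (node cs ∷ ts) (i ∷ v) r =
  edge (letter-complement b i) (perimeterWord-valid (not b) cs _ _) (perimeterWord-valid b ts _ r)

edgeColouring : ∀ {ts} {w r : List (Letter m)} → ValidF ts w r → Vec (Fin m) (edgesF ts)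
edgeColouring done         = []
edgeColouring (edge c p q) = index c ∷ (edgeColouring p ++ edgeColouring q)

edgeColouring-perimeterWord : ∀ b ts (v : Vec (Fin m) (edgesF ts)) r →
                              edgeColouring (perimeterWord-valid b ts v r) ≡ v
edgeColouring-perimeterWord b []             []      r = refl
edgeColouring-perimeterWord b (node cs ∷ ts) (i ∷ v) r =
  cong₂ _∷_ (index-letter-complement b i) (begin
    edgeColouring (perimeterWord-valid (not b) cs (take (edgesF cs) v) _)
      ++ edgeColouring (perimeterWord-valid b ts (drop (edgesF cs) v) r)
      ≡⟨ cong₂ _++_ (edgeColouring-perimeterWord (not b) cs _ _)
                    (edgeColouring-perimeterWord b ts _ r) ⟩
    take (edgesF cs) v ++ drop (edgesF cs) v
      ≡⟨ take++drop≡id (edgesF cs) v ⟩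
    v ∎)
  where open ≡-Reasoning

ValidF-length : ∀ {ts} {w r : List (Letter m)} → ValidF ts w r → length w ≡ 2 * edgesF ts + length r
ValidF-length done = refl
ValidF-length {ts = node cs ∷ ts} {r = r} (edge _ p q)
  rewrite ValidF-length p | ValidF-length q = cong suc (arith (edgesF cs) (edgesF ts) (length r))
  where
  arith : ∀ x y z → 2 * x + suc (2 * y + z) ≡ x + y + suc (x + y + 0) + z
  arith = solve-∀

WValid-length : ∀ {ts} {w : List (Letter m)} → ValidF ts w [] → length w ≡ 2 * edgesF ts
WValid-length {ts = ts} p = trans (ValidF-length p) (+-identityʳ (2 * edgesF ts))

ValidF-functional : ∀ {ts} {w r r′ : List (Letter m)} → ValidF ts w r → ValidF ts w r′ → r ≡ r′
ValidF-functional done         done           = refl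
ValidF-functional (edge _ p q) (edge _ p′ q′) with ValidF-functional p p′
... | refl = ValidF-functional q q′

ValidF-irrelevant : ∀ {ts} {w r : List (Letter m)} (p q : ValidF ts w r) → p ≡ q
ValidF-irrelevant done         done           = refl
ValidF-irrelevant (edge c p q) (edge d p′ q′) with ValidF-functional p p′
... | refl rewrite Complement-irrelevant c d | ValidF-irrelevant p p′ | ValidF-irrelevant q q′ = refl

-- w alternates, starts with polarity b, and ends with a barred letter (or is empty and
-- b = true): the suffixes of words in P̂(n,m).
data AlternatingFrom {m : ℕ} : Bool → List (Letter m) → Set where
  []    : AlternatingFrom true []
  A∷_   : ∀ {i w} → AlternatingFrom false w → AlternatingFrom true  (A i ∷ w)
  Abar∷_ : ∀ {i w} → AlternatingFrom true  w → AlternatingFrom false (Abar i ∷ w)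

AlternatingFrom-tail : ∀ {b} {x : Letter m} {w} → AlternatingFrom b (x ∷ w) → AlternatingFrom (not b) w
AlternatingFrom-tail (A∷ p)    = p
AlternatingFrom-tail (Abar∷ p) = p

letter-∷ : ∀ b (i : Fin m) {w} → AlternatingFrom (not b) w → AlternatingFrom b (letter b i ∷ w)
letter-∷ true  i p = A∷ p
letter-∷ false i p = Abar∷ p

AlternatingFrom-not : ∀ {b} {w : List (Letter m)} → AlternatingFrom b w → AlternatingFrom (not (not b)) w
AlternatingFrom-not {b = b} = subst (λ b′ → AlternatingFrom b′ _) (sym (not-involutive b))

AlternatingFrom-notnot : ∀ {b} {w : List (Letter m)} → AlternatingFrom (not (not b)) w → AlternatingFrom b w
AlternatingFrom-notnot {b = b} = subst (λ b′ → AlternatingFrom b′ _) (not-involutive b)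

ValidF-alternatingFrom : ∀ {b ts} {w r : List (Letter m)} →
                         AlternatingFrom b w → ValidF ts w r → AlternatingFrom b r
ValidF-alternatingFrom a done = a
ValidF-alternatingFrom a (edge _ p q) =
  ValidF-alternatingFrom
    (AlternatingFrom-notnot (AlternatingFrom-tail (ValidF-alternatingFrom (AlternatingFrom-tail a) p))) q

perimeterWord-alternatingFrom : ∀ b ts (v : Vec (Fin m) (edgesF ts)) {r} →
                                AlternatingFrom b r → AlternatingFrom b (perimeterWord b ts v r)
perimeterWord-alternatingFrom b []             []      a = a
perimeterWord-alternatingFrom b (node cs ∷ ts) (i ∷ v) a =
  letter-∷ b i (perimeterWord-alternatingFrom (not b) cs _
                 (letter-∷ (not b) i (AlternatingFrom-not (perimeterWord-alternatingFrom b ts _ a))))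

complement-letters : ∀ b {x y : Letter m} {w} → AlternatingFrom b (x ∷ w) → (c : Complement x y) →
                     x ≡ letter b (index c) × y ≡ letter (not b) (index c)
complement-letters true  (A∷ _)    (A-Abar i) = refl , refl
complement-letters false (Abar∷ _) (Abar-A i) = refl , refl

perimeterWord-edgeColouring : ∀ b ts {w r : List (Letter m)} → AlternatingFrom b w →
                              (p : ValidF ts w r) → w ≡ perimeterWord b ts (edgeColouring p) r
perimeterWord-edgeColouring b [] a done = refl
perimeterWord-edgeColouring b (node cs ∷ ts) {r = r} a (edge c p q)
  rewrite take-++ (edgeColouring p) (edgeColouring q) | drop-++ (edgeColouring p) (edgeColouring q) =
  let (first , second) = complement-letters b a c
      a′ = AlternatingFrom-tail a
      a″ = AlternatingFrom-notnot (AlternatingFrom-tail (ValidF-alternatingFrom a′ p))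
  in cong₂ _∷_ first
       (trans (perimeterWord-edgeColouring (not b) cs a′ p)
              (cong (perimeterWord (not b) cs (edgeColouring p))
                    (cong₂ _∷_ second (perimeterWord-edgeColouring b ts a″ q))))

alternatingFrom-true : {w : List (Letter m)} → Alternating w → AlternatingFrom true w
alternatingFrom-true alt-nil                            = []
alternatingFrom-true (alt-cons (isA _) (isAbar _) p) = A∷ Abar∷ alternatingFrom-true p

alternating : {w : List (Letter m)} → AlternatingFrom true w → Alternating w
alternating []           = alt-nil
alternating (A∷ Abar∷ p) = alt-cons (isA _) (isAbar _) (alternating p)

Alternating-irrelevant : {w : List (Letter m)} (p q : Alternating w) → p ≡ q
Alternating-irrelevant alt-nil alt-nil = refl
Alternating-irrelevant (alt-cons (isA _) (isAbar _) p) (alt-cons (isA _) (isAbar _) q)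
  rewrite Alternating-irrelevant p q = refl

toColouring : ∀ n m → 𝒯 n m → 𝒞 n m
toColouring n m (w , node ts , (len , _ , _) , p) =
  node ts , *-cancelˡ-≡ (edgesF ts) n 2 (trans (sym (WValid-length p)) len) , edgeColouring p

fromColouring : ∀ n m → 𝒞 n m → 𝒯 n m
fromColouring n m (node ts , e , v) =
  w , node ts , (len , alternating (perimeterWord-alternatingFrom true ts v []) , folds (node ts , valid)) , valid
  where
  w = perimeterWord true ts v []
  valid = perimeterWord-valid true ts v []
  len = trans (WValid-length valid) (cong (2 *_) e)

𝒯-≡ : ∀ {n m} ts {w w′ : List (Letter m)} {l l′ a a′ f f′}
      (p : WValid w (node ts)) (p′ : WValid w′ (node ts)) → w ≡ w′ →
      _≡_ {A = 𝒯 n m} (w , node ts , (l , a , f) , p) (w′ , node ts , (l′ , a′ , f′) , p′)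
𝒯-≡ ts {l = l} {l′} {a} {a′} p p′ refl
  rewrite ≡-irrelevant l l′ | Alternating-irrelevant a a′ | ValidF-irrelevant p p′ = refl

𝒞-≡ : ∀ {n m} ts (e e′ : edgesF ts ≡ n) {v v′ : Vec (Fin m) (edgesF ts)} → v ≡ v′ →
      _≡_ {A = 𝒞 n m} (node ts , e , v) (node ts , e′ , v′)
𝒞-≡ ts e e′ refl rewrite ≡-irrelevant e e′ = refl

mainTheorem3 : (n m : ℕ) → 1 ≤ m → 𝒯 n m ↔ 𝒞 n m
mainTheorem3 n m _ = mk↔ₛ′ (toColouring n m) (fromColouring n m) to∘from from∘to
  where
  to∘from : ∀ c → toColouring n m (fromColouring n m c) ≡ c
  to∘from (node ts , e , v) = 𝒞-≡ ts _ e (edgeColouring-perimeterWord true ts v [])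

  from∘to : ∀ t → fromColouring n m (toColouring n m t) ≡ t
  from∘to (w , node ts , (_ , a , _) , p) =
    𝒯-≡ {n} ts _ p (sym (perimeterWord-edgeColouring true ts (alternatingFrom-true a) p))
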